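{- Let $n>2$ be an integer such that $n/2$ is odd. Then there does not exist a complete MOFS$(n)$, i.e. there is no set of $(n-1)^2$ pairwise orthogonal binary frequency squares of order $n$.
   Context: Let $N(n)=\{1,\dots,n\}$ and let $n$ be even. A (binary) frequency square of order $n$ is an $n\times n$ array indexed by $N(n)\times N(n)$ with entries in $\{0,1\}$ such that every row and every column contains exactly $n/2$ zeros and $n/2$ ones. Two frequency squares $F,G$ of order $n$ are orthogonal if for each $(a,b)\in\{0,1\}^2$ the number of cells $(r,c)$ with $(F[r,c],G[r,c])=(a,b)$ equals $n^2/4$. A $k$-MOFS$(n)$ is a set of $k$ pairwise orthogonal frequency squares of order $n$; it is complete if $k=(n-1)^2$. -}

module Defs where

open import Data.Nat using (ℕ; _+_; _*_; _/_)
open import Data.Bool using (Bool; true; false; if_then_else_)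
open import Data.Bool.Properties using () renaming (_≟_ to _≟ᵇ_)
open import Data.Fin using (Fin)
open import Data.Product using (_×_; _,_)
open import Relation.Nullary using (¬_)
open import Relation.Nullary.Decidable using (does)
open import Relation.Binary.PropositionalEquality using (_≡_)

∑ : (n : ℕ) → (Fin n → ℕ) → ℕ
∑ ℕ.zero    f = 0
∑ (ℕ.suc n) f = f Fin.zero + ∑ n (λ i → f (Fin.suc i))

count : (n : ℕ) → (Fin n → Bool) → ℕ
count n P = ∑ n (λ i → if P i then 1 else 0)

-- an n×n binary array (entries 0 = false, 1 = true)
Array : ℕ → Set
Array n = Fin n → Fin n → Bool

rowCount : {n : ℕ} → Array n → Fin n → Bool → ℕ
rowCount {n} F r b = count n (λ c → does (F r c ≟ᵇ b))

colCount : {n : ℕ} → Array n → Fin n → Bool → ℕ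
colCount {n} F c b = count n (λ r → does (F r c ≟ᵇ b))

IsFrequencySquare : (n : ℕ) → Array n → Set
IsFrequencySquare n F =
  (∀ r b → rowCount F r b ≡ n / 2) × (∀ c b → colCount F c b ≡ n / 2)

pairCount : {n : ℕ} → Array n → Array n → Bool → Bool → ℕ
pairCount {n} F G a b =
  ∑ n (λ r → count n (λ c → does (F r c ≟ᵇ a) Data.Bool.∧ does (G r c ≟ᵇ b)))

Orthogonal : (n : ℕ) → Array n → Array n → Set
Orthogonal n F G = ∀ a b → pairCount F G a b ≡ (n * n) / 4

-- a k-MOFS(n): k frequency squares of order n, pairwise orthogonal
-- (indexed by Fin k; distinct indices give orthogonal, hence distinct, squares)
record MOFS (k n : ℕ) : Set where
  field
    square : Fin k → Array n
    isFreq : ∀ i → IsFrequencySquare n (square i)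
    orth   : ∀ i j → ¬ (i ≡ j) → Orthogonal n (square i) (square j)

CompleteMOFS : ℕ → Set
CompleteMOFS n = MOFS ((n Data.Nat.∸ 1) * (n Data.Nat.∸ 1)) n

-- Replace each square by its ±1 matrix. The (n−1)² matrices so obtained are pairwise
-- orthogonal, have squared norm n², and lie in the (n−1)²-dimensional space of matrices
-- whose rows and columns sum to zero, so they form an orthogonal basis of it. Hence the
-- completeness relation ∑ᵢ fᵢ(p) fᵢ(q) = n² P(p, q), with P the orthogonal projection onto
-- that space; it is proved without dimension theory by showing that the residual of the
-- expansion has norm zero. For three cells p, q, s of one row, every summand of
-- ∑ᵢ (fᵢ(p) + fᵢ(q)) (fᵢ(p) + fᵢ(s)) is 0 or 4, while the completeness relation evaluates
-- the sum to (n−1)² − 3(n−1) = (n−1)(n−4), which is 2 mod 4 when n is twice an odd number.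

module Submission where

open import Defs
open import Data.Nat using (ℕ; _<_; _/_)
open import Data.Nat.Divisibility using (_∣_)
open import Relation.Nullary using (¬_)

open import Data.Nat as ℕ using (zero; suc; s≤s)
import Data.Nat.Properties as ℕP
open import Data.Nat.Divisibility using (divides)
open import Data.Nat.DivMod using (m*n/n≡m)
open import Data.Integer using (ℤ; +_; -[1+_]; _+_; _*_; _-_; -_; 0ℤ; 1ℤ; -1ℤ; ∣_∣)
import Data.Integer.Properties as ℤP
import Data.Integer.Divisibility.Signed as ℤᵈ
open ℤᵈ using () renaming (_∣_ to _∣ℤ_)
open import Data.Integer.Tactic.RingSolver using (solve-∀)
open import Data.Fin using (Fin; zero; suc; _≟_)
open import Data.Fin.Properties using (suc-injective)
open import Data.Bool using (Bool; true; false; if_then_else_; _∧_)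
open import Data.Bool.Properties using () renaming (_≟_ to _≟ᵇ_)
open import Data.Product using (_,_)
open import Data.Sum using ([_,_]′)
open import Function using (id; _∘_)
open import Relation.Nullary.Decidable using (does; dec-true; dec-false)
open import Relation.Binary.PropositionalEquality
open import Algebra.Properties.Semiring.Sum ℤP.+-*-semiring

open ≡-Reasoning

∑-neg : ∀ {n} (f : Fin n → ℤ) → ∑[ i < n ] (- f i) ≡ - sum f
∑-neg {n} f = begin
  ∑[ i < n ] (- f i)      ≡⟨ sum-cong-≗ (λ i → ℤP.-1*i≡-i (f i)) ⟨
  ∑[ i < n ] (-1ℤ * f i)  ≡⟨ *-distribˡ-sum -1ℤ f ⟨
  -1ℤ * sum f             ≡⟨ ℤP.-1*i≡-i (sum f) ⟩
  - sum f                 ∎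

∑-distrib-- : ∀ {n} (f g : Fin n → ℤ) → ∑[ i < n ] (f i - g i) ≡ sum f - sum g
∑-distrib-- f g = trans (∑-distrib-+ f (λ i → - g i)) (cong (_+_ (sum f)) (∑-neg g))

∑-const : ∀ n (x : ℤ) → ∑[ i < n ] x ≡ + n * x
∑-const zero    x = sym (ℤP.*-zeroˡ x)
∑-const (suc n) x = begin
  x + ∑[ i < n ] x  ≡⟨ cong (_+_ x) (∑-const n x) ⟩
  x + + n * x       ≡⟨ cong (_+ + n * x) (ℤP.*-identityˡ x) ⟨
  1ℤ * x + + n * x  ≡⟨ ℤP.*-distribʳ-+ x 1ℤ (+ n) ⟨
  (1ℤ + + n) * x    ≡⟨ cong (_* x) (ℤP.pos-+ 1 n) ⟨
  + suc n * x       ∎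

sum-zero : ∀ {n} {f : Fin n → ℤ} → (∀ i → f i ≡ 0ℤ) → sum f ≡ 0ℤ
sum-zero {n} f≗0 = trans (sum-cong-≗ f≗0) (sum-replicate-zero n)

∑-scale-zero : ∀ {n} x (g : Fin n → ℤ) → sum g ≡ 0ℤ → ∑[ i < n ] (x * g i) ≡ 0ℤ
∑-scale-zero x g ∑g≡0 = trans (sym (*-distribˡ-sum x g)) (trans (cong (x *_) ∑g≡0) (ℤP.*-zeroʳ x))

sum-single : ∀ {n} (f : Fin n → ℤ) j → (∀ i → i ≢ j → f i ≡ 0ℤ) → sum f ≡ f j
sum-single f zero    f≡0 =
  trans (cong (_+_ (f zero)) (sum-zero (λ i → f≡0 (suc i) λ ()))) (ℤP.+-identityʳ (f zero))
sum-single f (suc j) f≡0 =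
  trans (cong₂ _+_ (f≡0 zero λ ()) (sum-single (f ∘ suc) j (λ i i≢j → f≡0 (suc i) (i≢j ∘ suc-injective))))
        (ℤP.+-identityˡ (f (suc j)))

pos-∑ : ∀ n (h : Fin n → ℕ) → + ∑ n h ≡ ∑[ i < n ] (+ h i)
pos-∑ zero    h = refl
pos-∑ (suc n) h = trans (ℤP.pos-+ (h zero) _) (cong (_+_ (+ h zero)) (pos-∑ n (λ i → h (suc i))))

∑≡0⇒≡0 : ∀ n (h : Fin n → ℕ) → ∑ n h ≡ 0 → ∀ i → h i ≡ 0
∑≡0⇒≡0 (suc n) h ∑h≡0 zero    = ℕP.m+n≡0⇒m≡0 (h zero) ∑h≡0
∑≡0⇒≡0 (suc n) h ∑h≡0 (suc i) = ∑≡0⇒≡0 n (λ j → h (suc j)) (ℕP.m+n≡0⇒n≡0 (h zero) ∑h≡0) i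

∑-∣ : ∀ {n d} (f : Fin n → ℤ) → (∀ i → d ∣ℤ f i) → d ∣ℤ sum f
∑-∣ {zero}  f d∣f = ℤᵈ.divides 0ℤ refl
∑-∣ {suc n} f d∣f = ℤᵈ.∣m∣n⇒∣m+n (d∣f zero) (∑-∣ (λ i → f (suc i)) (λ i → d∣f (suc i)))

δ : ∀ {n} → Fin n → Fin n → ℤ
δ i j = if does (i ≟ j) then 1ℤ else 0ℤ

δ-refl : ∀ {n} (i : Fin n) → δ i i ≡ 1ℤ
δ-refl i rewrite dec-true (i ≟ i) refl = refl

δ-≢ : ∀ {n} {i j : Fin n} → j ≢ i → δ i j ≡ 0ℤ
δ-≢ {i = i} {j} j≢i rewrite dec-false (i ≟ j) (λ i≡j → j≢i (sym i≡j)) = refl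

∑-δ-* : ∀ {n} (i : Fin n) (g : Fin n → ℤ) → ∑[ j < n ] (δ i j * g j) ≡ g i
∑-δ-* i g = begin
  ∑[ j < _ ] (δ i j * g j)  ≡⟨ sum-single _ i (λ j j≢i → cong (_* g j) (δ-≢ j≢i)) ⟩
  δ i i * g i               ≡⟨ cong (_* g i) (δ-refl i) ⟩
  1ℤ * g i                  ≡⟨ ℤP.*-identityˡ (g i) ⟩
  g i                       ∎

Matrix : ℕ → Set
Matrix n = Fin n → Fin n → ℤ

total : ∀ {n} → Matrix n → ℤ
total {n} u = ∑[ r < n ] ∑[ c < n ] u r c

infix 7 _·_
_·_ : ∀ {n} → Matrix n → Matrix n → ℤ
u · v = total (λ r c → u r c * v r c)

_-ᴹ_ : ∀ {n} → Matrix n → Matrix n → Matrix n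
(u -ᴹ v) r c = u r c - v r c

total-cong : ∀ {n} {u v : Matrix n} → (∀ r c → u r c ≡ v r c) → total u ≡ total v
total-cong u≗v = sum-cong-≗ (λ r → sum-cong-≗ (u≗v r))

total-distrib-+ : ∀ {n} (u v : Matrix n) → total (λ r c → u r c + v r c) ≡ total u + total v
total-distrib-+ {n} u v =
  trans (sum-cong-≗ (λ r → ∑-distrib-+ (u r) (v r)))
        (∑-distrib-+ (λ r → ∑[ c < n ] u r c) (λ r → ∑[ c < n ] v r c))

total-distrib-- : ∀ {n} (u v : Matrix n) → total (u -ᴹ v) ≡ total u - total v
total-distrib-- {n} u v =
  trans (sum-cong-≗ (λ r → ∑-distrib-- (u r) (v r)))
        (∑-distrib-- (λ r → ∑[ c < n ] u r c) (λ r → ∑[ c < n ] v r c))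

*-distribˡ-total : ∀ {n} x (u : Matrix n) → x * total u ≡ total (λ r c → x * u r c)
*-distribˡ-total {n} x u =
  trans (*-distribˡ-sum x (λ r → ∑[ c < n ] u r c)) (sum-cong-≗ (λ r → *-distribˡ-sum x (u r)))

·-comm : ∀ {n} (u v : Matrix n) → u · v ≡ v · u
·-comm u v = total-cong (λ r c → ℤP.*-comm (u r c) (v r c))

·-distribˡ-- : ∀ {n} (u v w : Matrix n) → u · (v -ᴹ w) ≡ u · v - u · w
·-distribˡ-- u v w =
  trans (total-cong (λ r c → distrib (u r c) (v r c) (w r c)))
        (total-distrib-- (λ r c → u r c * v r c) (λ r c → u r c * w r c))
  where
  distrib : ∀ x y z → x * (y - z) ≡ x * y - x * z
  distrib = solve-∀

i*i≡+∣i∣*∣i∣ : ∀ i → i * i ≡ + (∣ i ∣ ℕ.* ∣ i ∣)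
i*i≡+∣i∣*∣i∣ (+ m)    = sym (ℤP.pos-* m m)
i*i≡+∣i∣*∣i∣ -[1+ m ] = refl

·-self≡0⇒≡0 : ∀ {n} (u : Matrix n) → u · u ≡ 0ℤ → ∀ r c → u r c ≡ 0ℤ
·-self≡0⇒≡0 {n} u u·u≡0 r c =
  [ id , id ]′ (ℤP.i*j≡0⇒i≡0∨j≡0 (u r c)
    (trans (i*i≡+∣i∣*∣i∣ (u r c)) (cong +_ (∑≡0⇒≡0 n (sq r) (∑≡0⇒≡0 n _ ∑∑sq≡0 r) c))))
  where
  sq : Fin n → Fin n → ℕ
  sq r c = ∣ u r c ∣ ℕ.* ∣ u r c ∣

  u·u≡+∑∑sq : u · u ≡ + ∑ n (λ r → ∑ n (sq r))
  u·u≡+∑∑sq = begin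
    u · u                          ≡⟨ total-cong (λ r c → i*i≡+∣i∣*∣i∣ (u r c)) ⟩
    total (λ r c → + sq r c)       ≡⟨ sum-cong-≗ (λ r → pos-∑ n (sq r)) ⟨
    ∑[ r < n ] (+ ∑ n (sq r))      ≡⟨ pos-∑ n _ ⟨
    + ∑ n (λ r → ∑ n (sq r))       ∎

  ∑∑sq≡0 : ∑ n (λ r → ∑ n (sq r)) ≡ 0
  ∑∑sq≡0 = ℤP.+-injective (trans (sym u·u≡+∑∑sq) u·u≡0)

record Balanced {n} (u : Matrix n) : Set where
  field
    rows : ∀ r → ∑[ c < n ] u r c ≡ 0ℤ
    cols : ∀ c → ∑[ r < n ] u r c ≡ 0ℤ
open Balanced

-ᴹ-balanced : ∀ {n} {u v : Matrix n} → Balanced u → Balanced v → Balanced (u -ᴹ v)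
rows (-ᴹ-balanced {u = u} {v} bu bv) r =
  trans (∑-distrib-- (u r) (v r)) (cong₂ _-_ (rows bu r) (rows bv r))
cols (-ᴹ-balanced {u = u} {v} bu bv) c =
  trans (∑-distrib-- (λ r → u r c) (λ r → v r c)) (cong₂ _-_ (cols bu c) (cols bv c))

-- n times the projection onto vectors with zero sum, so that kernel r₀ c₀ r c = n² P((r₀, c₀), (r, c)).
centre : ∀ {n} → Fin n → Fin n → ℤ
centre {n} a b = + n * δ a b - 1ℤ

centre-diag : ∀ {n} (a : Fin n) → centre a a ≡ + n - 1ℤ
centre-diag {n} a = trans (cong (λ d → + n * d - 1ℤ) (δ-refl a)) (cong (_- 1ℤ) (ℤP.*-identityʳ (+ n)))

centre-≢ : ∀ {n} {a b : Fin n} → b ≢ a → centre a b ≡ -1ℤ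
centre-≢ {n} b≢a = trans (cong (λ d → + n * d - 1ℤ) (δ-≢ b≢a)) (cong (_- 1ℤ) (ℤP.*-zeroʳ (+ n)))

∑-centre-* : ∀ {n} (a : Fin n) (g : Fin n → ℤ) → ∑[ b < n ] (centre a b * g b) ≡ + n * g a - sum g
∑-centre-* {n} a g = begin
  ∑[ b < n ] (centre a b * g b)             ≡⟨ sum-cong-≗ (λ b → expand (+ n) (δ a b) (g b)) ⟩
  ∑[ b < n ] (+ n * (δ a b * g b) - g b)    ≡⟨ ∑-distrib-- (λ b → + n * (δ a b * g b)) g ⟩
  ∑[ b < n ] (+ n * (δ a b * g b)) - sum g  ≡⟨ cong (_- sum g) (*-distribˡ-sum (+ n) (λ b → δ a b * g b)) ⟨
  + n * ∑[ b < n ] (δ a b * g b) - sum g    ≡⟨ cong (λ s → + n * s - sum g) (∑-δ-* a g) ⟩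
  + n * g a - sum g                         ∎
  where
  expand : ∀ m d x → (m * d - 1ℤ) * x ≡ m * (d * x) - x
  expand = solve-∀

∑-centre-*-balanced : ∀ {n} (a : Fin n) (g : Fin n → ℤ) → sum g ≡ 0ℤ →
                     ∑[ b < n ] (centre a b * g b) ≡ + n * g a
∑-centre-*-balanced {n} a g ∑g≡0 =
  trans (∑-centre-* a g) (trans (cong (λ s → + n * g a - s) ∑g≡0) (ℤP.+-identityʳ (+ n * g a)))

∑-centre : ∀ {n} (a : Fin n) → ∑[ b < n ] centre a b ≡ 0ℤ
∑-centre {n} a = begin
  ∑[ b < n ] centre a b              ≡⟨ sum-cong-≗ (λ b → ℤP.*-identityʳ (centre a b)) ⟨
  ∑[ b < n ] (centre a b * 1ℤ)       ≡⟨ ∑-centre-* a (λ _ → 1ℤ) ⟩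
  + n * 1ℤ - ∑[ b < n ] 1ℤ           ≡⟨ cong (λ s → + n * 1ℤ - s) (∑-const n 1ℤ) ⟩
  + n * 1ℤ - + n * 1ℤ                ≡⟨ ℤP.+-inverseʳ (+ n * 1ℤ) ⟩
  0ℤ                                 ∎

kernel : ∀ {n} → Fin n → Fin n → Matrix n
kernel r₀ c₀ r c = centre r₀ r * centre c₀ c

kernel-balanced : ∀ {n} (r₀ c₀ : Fin n) → Balanced (kernel r₀ c₀)
rows (kernel-balanced r₀ c₀) r = ∑-scale-zero (centre r₀ r) (centre c₀) (∑-centre c₀)
cols (kernel-balanced r₀ c₀) c =
  trans (sym (*-distribʳ-sum (centre c₀ c) (centre r₀)))
        (trans (cong (_* centre c₀ c) (∑-centre r₀)) (ℤP.*-zeroˡ (centre c₀ c)))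

kernel-· : ∀ {n} (r₀ c₀ : Fin n) {v : Matrix n} → Balanced v → kernel r₀ c₀ · v ≡ + n * (+ n * v r₀ c₀)
kernel-· {n} r₀ c₀ {v} bv = begin
  total (λ r c → centre r₀ r * centre c₀ c * v r c)
    ≡⟨ total-cong (λ r c → reassoc (centre r₀ r) (centre c₀ c) (v r c)) ⟩
  ∑[ r < n ] ∑[ c < n ] (centre c₀ c * (centre r₀ r * v r c))
    ≡⟨ sum-cong-≗ (λ r → ∑-centre-*-balanced c₀ (λ c → centre r₀ r * v r c)
                          (∑-scale-zero (centre r₀ r) (v r) (rows bv r))) ⟩
  ∑[ r < n ] (+ n * (centre r₀ r * v r c₀))
    ≡⟨ sum-cong-≗ (λ r → swap (+ n) (centre r₀ r) (v r c₀)) ⟩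
  ∑[ r < n ] (centre r₀ r * (+ n * v r c₀))
    ≡⟨ ∑-centre-*-balanced r₀ (λ r → + n * v r c₀) (∑-scale-zero (+ n) (λ r → v r c₀) (cols bv c₀)) ⟩
  + n * (+ n * v r₀ c₀) ∎
  where
  reassoc : ∀ x y z → x * y * z ≡ y * (x * z)
  reassoc = solve-∀
  swap : ∀ x y z → x * (y * z) ≡ y * (x * z)
  swap = solve-∀

module Completeness {n k : ℕ} (f : Fin k → Matrix n)
  (f²≡1 : ∀ i r c → f i r c * f i r c ≡ 1ℤ)
  (f-balanced : ∀ i → Balanced (f i))
  (f-orthogonal : ∀ i j → i ≢ j → f i · f j ≡ 0ℤ)
  (k≡[n-1]² : + k ≡ (+ n - 1ℤ) * (+ n - 1ℤ))
  where

  ·-self : ∀ i → f i · f i ≡ + n * + n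
  ·-self i = begin
    f i · f i               ≡⟨ total-cong (f²≡1 i) ⟩
    ∑[ r < n ] ∑[ c < n ] 1ℤ ≡⟨ sum-cong-≗ {n} (λ _ → trans (∑-const n 1ℤ) (ℤP.*-identityʳ (+ n))) ⟩
    ∑[ r < n ] (+ n)        ≡⟨ ∑-const n (+ n) ⟩
    + n * + n               ∎

  combination : (Fin k → ℤ) → Matrix n
  combination a r c = ∑[ i < k ] (a i * f i r c)

  combination-balanced : ∀ a → Balanced (combination a)
  rows (combination-balanced a) r = trans (∑-comm (λ c i → a i * f i r c))
    (sum-zero (λ i → ∑-scale-zero (a i) (f i r) (rows (f-balanced i) r)))
  cols (combination-balanced a) c = trans (∑-comm (λ r i → a i * f i r c))
    (sum-zero (λ i → ∑-scale-zero (a i) (λ r → f i r c) (cols (f-balanced i) c)))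

  combination-· : ∀ a v → combination a · v ≡ ∑[ i < k ] (a i * (f i · v))
  combination-· a v = begin
    total (λ r c → ∑[ i < k ] (a i * f i r c) * v r c)
      ≡⟨ total-cong (λ r c → *-distribʳ-sum (v r c) (λ i → a i * f i r c)) ⟩
    ∑[ r < n ] ∑[ c < n ] ∑[ i < k ] (a i * f i r c * v r c)
      ≡⟨ sum-cong-≗ (λ r → ∑-comm (λ c i → a i * f i r c * v r c)) ⟩
    ∑[ r < n ] ∑[ i < k ] ∑[ c < n ] (a i * f i r c * v r c)
      ≡⟨ ∑-comm (λ r i → ∑[ c < n ] (a i * f i r c * v r c)) ⟩
    ∑[ i < k ] total (λ r c → a i * f i r c * v r c)
      ≡⟨ sum-cong-≗ (λ i → total-cong (λ r c → ℤP.*-assoc (a i) (f i r c) (v r c))) ⟩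
    ∑[ i < k ] total (λ r c → a i * (f i r c * v r c))
      ≡⟨ sum-cong-≗ (λ i → *-distribˡ-total (a i) (λ r c → f i r c * v r c)) ⟨
    ∑[ i < k ] (a i * (f i · v)) ∎

  f·combination : ∀ a j → f j · combination a ≡ a j * (+ n * + n)
  f·combination a j = begin
    f j · combination a                  ≡⟨ ·-comm (f j) (combination a) ⟩
    combination a · f j                  ≡⟨ combination-· a (f j) ⟩
    ∑[ i < k ] (a i * (f i · f j))       ≡⟨ sum-single _ j orthogonal-terms ⟩
    a j * (f j · f j)                    ≡⟨ cong (a j *_) (·-self j) ⟩
    a j * (+ n * + n)                    ∎
    where
    orthogonal-terms : ∀ i → i ≢ j → a i * (f i · f j) ≡ 0ℤ
    orthogonal-terms i i≢j = trans (cong (a i *_) (f-orthogonal i j i≢j)) (ℤP.*-zeroʳ (a i))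

  completeness : ∀ r₀ c₀ r c → ∑[ i < k ] (f i r₀ c₀ * f i r c) ≡ kernel r₀ c₀ r c
  completeness r₀ c₀ r c =
    sym (ℤP.i-j≡0⇒i≡j _ _ (·-self≡0⇒≡0 residual residual·residual≡0 r c))
    where
    a : Fin k → ℤ
    a i = f i r₀ c₀

    residual : Matrix n
    residual = kernel r₀ c₀ -ᴹ combination a

    residual-balanced : Balanced residual
    residual-balanced = -ᴹ-balanced (kernel-balanced r₀ c₀) (combination-balanced a)

    f·residual≡0 : ∀ j → f j · residual ≡ 0ℤ
    f·residual≡0 j = begin
      f j · residual                            ≡⟨ ·-distribˡ-- (f j) (kernel r₀ c₀) (combination a) ⟩
      f j · kernel r₀ c₀ - f j · combination a  ≡⟨ cong₂ _-_ (trans (·-comm (f j) (kernel r₀ c₀))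
                                                                    (kernel-· r₀ c₀ (f-balanced j)))
                                                             (f·combination a j) ⟩
      + n * (+ n * a j) - a j * (+ n * + n)     ≡⟨ cancel (+ n) (a j) ⟩
      0ℤ                                        ∎
      where
      cancel : ∀ m x → m * (m * x) - x * (m * m) ≡ 0ℤ
      cancel = solve-∀

    -- the only place where the number k of squares enters
    residual-at-centre : residual r₀ c₀ ≡ 0ℤ
    residual-at-centre = begin
      kernel r₀ c₀ r₀ c₀ - ∑[ i < k ] (a i * a i)
        ≡⟨ cong₂ _-_ (cong₂ _*_ (centre-diag r₀) (centre-diag c₀)) ∑a²≡k ⟩
      (+ n - 1ℤ) * (+ n - 1ℤ) - + k
        ≡⟨ cong (_-_ ((+ n - 1ℤ) * (+ n - 1ℤ))) k≡[n-1]² ⟩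
      (+ n - 1ℤ) * (+ n - 1ℤ) - (+ n - 1ℤ) * (+ n - 1ℤ)
        ≡⟨ ℤP.+-inverseʳ ((+ n - 1ℤ) * (+ n - 1ℤ)) ⟩
      0ℤ ∎
      where
      ∑a²≡k : ∑[ i < k ] (a i * a i) ≡ + k
      ∑a²≡k = trans (sum-cong-≗ (λ i → f²≡1 i r₀ c₀)) (trans (∑-const k 1ℤ) (ℤP.*-identityʳ (+ k)))

    residual·residual≡0 : residual · residual ≡ 0ℤ
    residual·residual≡0 = begin
      residual · residual
        ≡⟨ ·-distribˡ-- residual (kernel r₀ c₀) (combination a) ⟩
      residual · kernel r₀ c₀ - residual · combination a
        ≡⟨ cong₂ _-_ (trans (·-comm residual (kernel r₀ c₀)) (kernel-· r₀ c₀ residual-balanced))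
                     (trans (·-comm residual (combination a)) (combination-· a residual)) ⟩
      + n * (+ n * residual r₀ c₀) - ∑[ i < k ] (a i * (f i · residual))
        ≡⟨ cong₂ _-_ (cong (λ x → + n * (+ n * x)) residual-at-centre)
                     (sum-zero (λ i → trans (cong (a i *_) (f·residual≡0 i)) (ℤP.*-zeroʳ (a i)))) ⟩
      + n * (+ n * 0ℤ) - 0ℤ
        ≡⟨ vanish (+ n) ⟩
      0ℤ ∎
      where
      vanish : ∀ m → m * (m * 0ℤ) - 0ℤ ≡ 0ℤ
      vanish = solve-∀

  ∑-row-triple : ∀ r {c₀ c₁ c₂ : Fin n} → c₁ ≢ c₀ → c₂ ≢ c₀ → c₂ ≢ c₁ →
    ∑[ i < k ] ((f i r c₀ + f i r c₁) * (f i r c₀ + f i r c₂)) ≡ (+ n - 1ℤ) * (+ n - + 4)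
  ∑-row-triple r {c₀} {c₁} {c₂} c₁≢c₀ c₂≢c₀ c₂≢c₁ = begin
    ∑[ i < k ] ((x i + y i) * (x i + z i))
      ≡⟨ sum-cong-≗ (λ i → expand (x i) (y i) (z i)) ⟩
    ∑[ i < k ] (x i * x i + x i * y i + x i * z i + y i * z i)
      ≡⟨ ∑-distrib-+₄ (λ i → x i * x i) (λ i → x i * y i) (λ i → x i * z i) (λ i → y i * z i) ⟩
    ∑[ i < k ] (x i * x i) + ∑[ i < k ] (x i * y i) + ∑[ i < k ] (x i * z i) + ∑[ i < k ] (y i * z i)
      ≡⟨ cong₂ _+_ (cong₂ _+_ (cong₂ _+_ (completeness r c₀ r c₀) (completeness r c₀ r c₁))
                              (completeness r c₀ r c₂)) (completeness r c₁ r c₂) ⟩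
    kernel r c₀ r c₀ + kernel r c₀ r c₁ + kernel r c₀ r c₂ + kernel r c₁ r c₂
      ≡⟨ cong₂ _+_ (cong₂ _+_ (cong₂ _+_ (cong₂ _*_ (centre-diag r) (centre-diag c₀))
                                         (cong₂ _*_ (centre-diag r) (centre-≢ c₁≢c₀)))
                              (cong₂ _*_ (centre-diag r) (centre-≢ c₂≢c₀)))
                   (cong₂ _*_ (centre-diag r) (centre-≢ c₂≢c₁)) ⟩
    m * m + m * -1ℤ + m * -1ℤ + m * -1ℤ
      ≡⟨ collect (+ n) ⟩
    (+ n - 1ℤ) * (+ n - + 4) ∎
    where
    x y z : Fin k → ℤ
    x i = f i r c₀
    y i = f i r c₁
    z i = f i r c₂
    m : ℤ
    m = + n - 1ℤ
    expand : ∀ a b c → (a + b) * (a + c) ≡ a * a + a * b + a * c + b * c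
    expand = solve-∀
    collect : ∀ N → (N - 1ℤ) * (N - 1ℤ) + (N - 1ℤ) * -1ℤ + (N - 1ℤ) * -1ℤ + (N - 1ℤ) * -1ℤ
                    ≡ (N - 1ℤ) * (N - + 4)
    collect = solve-∀
    ∑-distrib-+₄ : ∀ (g₁ g₂ g₃ g₄ : Fin k → ℤ) →
      ∑[ i < k ] (g₁ i + g₂ i + g₃ i + g₄ i) ≡ sum g₁ + sum g₂ + sum g₃ + sum g₄
    ∑-distrib-+₄ g₁ g₂ g₃ g₄ =
      trans (∑-distrib-+ (λ i → g₁ i + g₂ i + g₃ i) g₄)
            (cong (_+ sum g₄) (trans (∑-distrib-+ (λ i → g₁ i + g₂ i) g₃)
                                     (cong (_+ sum g₃) (∑-distrib-+ g₁ g₂))))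

sign : Bool → ℤ
sign false = 1ℤ
sign true  = -1ℤ

sign*sign≡1 : ∀ b → sign b * sign b ≡ 1ℤ
sign*sign≡1 false = refl
sign*sign≡1 true  = refl

signMatrix : ∀ {n} → Array n → Matrix n
signMatrix F r c = sign (F r c)

indicator : Bool → ℤ
indicator b = + (if b then 1 else 0)

pos-count : ∀ n (P : Fin n → Bool) → + count n P ≡ ∑[ i < n ] indicator (P i)
pos-count n P = pos-∑ n _

sign≡indicator-indicator : ∀ b → sign b ≡ indicator (does (b ≟ᵇ false)) - indicator (does (b ≟ᵇ true))
sign≡indicator-indicator false = refl
sign≡indicator-indicator true  = refl

∑-sign : ∀ n (g : Fin n → Bool) →
  ∑[ i < n ] sign (g i) ≡ + count n (λ i → does (g i ≟ᵇ false)) - + count n (λ i → does (g i ≟ᵇ true))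
∑-sign n g = begin
  ∑[ i < n ] sign (g i)
    ≡⟨ sum-cong-≗ (λ i → sign≡indicator-indicator (g i)) ⟩
  ∑[ i < n ] (indicator (does (g i ≟ᵇ false)) - indicator (does (g i ≟ᵇ true)))
    ≡⟨ ∑-distrib-- (λ i → indicator (does (g i ≟ᵇ false))) (λ i → indicator (does (g i ≟ᵇ true))) ⟩
  ∑[ i < n ] indicator (does (g i ≟ᵇ false)) - ∑[ i < n ] indicator (does (g i ≟ᵇ true))
    ≡⟨ cong₂ _-_ (pos-count n _) (pos-count n _) ⟨
  + count n (λ i → does (g i ≟ᵇ false)) - + count n (λ i → does (g i ≟ᵇ true)) ∎

frequencySquare⇒balanced : ∀ {n} {F : Array n} → IsFrequencySquare n F → Balanced (signMatrix F)
rows (frequencySquare⇒balanced {n} {F} (rowCount≡ , _)) r =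
  trans (∑-sign n (F r)) (trans (cong₂ (λ p q → + p - + q) (rowCount≡ r false) (rowCount≡ r true))
                                (ℤP.+-inverseʳ (+ (n / 2))))
cols (frequencySquare⇒balanced {n} {F} (_ , colCount≡)) c =
  trans (∑-sign n (λ r → F r c)) (trans (cong₂ (λ p q → + p - + q) (colCount≡ c false) (colCount≡ c true))
                                        (ℤP.+-inverseʳ (+ (n / 2))))

pairIndicator : Bool → Bool → Bool → Bool → ℤ
pairIndicator a b x y = indicator (does (a ≟ᵇ x) ∧ does (b ≟ᵇ y))

sign*sign≡pairIndicator : ∀ a b → sign a * sign b ≡
  (pairIndicator a b false false + pairIndicator a b true true)
    - (pairIndicator a b false true + pairIndicator a b true false)
sign*sign≡pairIndicator false false = refl
sign*sign≡pairIndicator false true  = refl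
sign*sign≡pairIndicator true  false = refl
sign*sign≡pairIndicator true  true  = refl

pos-pairCount : ∀ {n} (F G : Array n) x y →
  + pairCount F G x y ≡ total (λ r c → pairIndicator (F r c) (G r c) x y)
pos-pairCount {n} F G x y =
  trans (pos-∑ n _) (sum-cong-≗ {n} (λ r → pos-count n (λ c → does (F r c ≟ᵇ x) ∧ does (G r c ≟ᵇ y))))

orthogonal⇒·≡0 : ∀ {n} {F G : Array n} → Orthogonal n F G → signMatrix F · signMatrix G ≡ 0ℤ
orthogonal⇒·≡0 {n} {F} {G} orthogonal = begin
  signMatrix F · signMatrix G
    ≡⟨ total-cong (λ r c → sign*sign≡pairIndicator (F r c) (G r c)) ⟩
  total (λ r c → (A false false r c + A true true r c) - (A false true r c + A true false r c))
    ≡⟨ total-distrib-- (λ r c → A false false r c + A true true r c)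
                       (λ r c → A false true r c + A true false r c) ⟩
  total (λ r c → A false false r c + A true true r c) - total (λ r c → A false true r c + A true false r c)
    ≡⟨ cong₂ _-_ (total-distrib-+ (A false false) (A true true)) (total-distrib-+ (A false true) (A true false)) ⟩
  (total (A false false) + total (A true true)) - (total (A false true) + total (A true false))
    ≡⟨ cong₂ _-_ (cong₂ _+_ (count≡ false false) (count≡ true true))
                 (cong₂ _+_ (count≡ false true) (count≡ true false)) ⟩
  (N + N) - (N + N)
    ≡⟨ ℤP.+-inverseʳ (N + N) ⟩
  0ℤ ∎
  where
  A : Bool → Bool → Matrix n
  A x y r c = pairIndicator (F r c) (G r c) x y
  N : ℤ
  N = + (n ℕ.* n / 4)
  count≡ : ∀ x y → total (A x y) ≡ N
  count≡ x y = trans (sym (pos-pairCount F G x y)) (cong +_ (orthogonal x y))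

4∣[sign+sign]*[sign+sign] : ∀ u v w → + 4 ∣ℤ (sign u + sign v) * (sign u + sign w)
4∣[sign+sign]*[sign+sign] false false false = ℤᵈ.divides 1ℤ refl
4∣[sign+sign]*[sign+sign] true  true  true  = ℤᵈ.divides 1ℤ refl
4∣[sign+sign]*[sign+sign] false true  _     = ℤᵈ.divides 0ℤ refl
4∣[sign+sign]*[sign+sign] true  false _     = ℤᵈ.divides 0ℤ refl
4∣[sign+sign]*[sign+sign] false false true  = ℤᵈ.divides 0ℤ refl
4∣[sign+sign]*[sign+sign] true  true  false = ℤᵈ.divides 0ℤ refl

completeMOFS⇒4∣[n-1][n-4] : ∀ {n} → 2 < n → CompleteMOFS n → + 4 ∣ℤ (+ n - 1ℤ) * (+ n - + 4)
completeMOFS⇒4∣[n-1][n-4] {suc (suc (suc m))} (s≤s (s≤s (s≤s _))) mofs =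
  subst (+ 4 ∣ℤ_) (∑-row-triple zero (λ ()) (λ ()) (λ ()))
    (∑-∣ _ (λ i → 4∣[sign+sign]*[sign+sign] (square i zero zero) (square i zero (suc zero))
                                             (square i zero (suc (suc zero)))))
  where
  open MOFS mofs
  k≡[n-1]² : + ((2 ℕ.+ m) ℕ.* (2 ℕ.+ m)) ≡ (+ (3 ℕ.+ m) - 1ℤ) * (+ (3 ℕ.+ m) - 1ℤ)
  k≡[n-1]² = trans (ℤP.pos-* (2 ℕ.+ m) (2 ℕ.+ m)) (sym (cong₂ _*_ (pred (+ (2 ℕ.+ m))) (pred (+ (2 ℕ.+ m)))))
    where
    pred : ∀ x → 1ℤ + x - 1ℤ ≡ x
    pred = solve-∀
  open Completeness (λ i → signMatrix (square i)) (λ i r c → sign*sign≡1 (square i r c))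
    (λ i → frequencySquare⇒balanced (isFreq i))
    (λ i j i≢j → orthogonal⇒·≡0 {F = square i} {square j} (orth i j i≢j)) k≡[n-1]²

4∣[2q-1][2q-4]⇒2∣q : ∀ q → + 4 ∣ℤ (+ q * + 2 - 1ℤ) * (+ q * + 2 - + 4) → 2 ∣ q
4∣[2q-1][2q-4]⇒2∣q q 4∣[2q-1][2q-4] =
  ℤᵈ.∣⇒∣ᵤ (ℤᵈ.*-cancelˡ-∣ (+ 2) {+ 2} (ℤᵈ.∣m+n∣m⇒∣n 4∣[2q-1][2q-4]+2q 4∣[2q-1][2q-4]))
  where
  identity : ∀ x → (x * + 2 - 1ℤ) * (x * + 2 - + 4) + + 2 * x ≡ + 4 * ((x - 1ℤ) * (x - 1ℤ))
  identity = solve-∀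
  4∣[2q-1][2q-4]+2q : + 4 ∣ℤ (+ q * + 2 - 1ℤ) * (+ q * + 2 - + 4) + + 2 * + q
  4∣[2q-1][2q-4]+2q =
    subst (+ 4 ∣ℤ_) (sym (identity (+ q))) (ℤᵈ.∣m⇒∣m*n ((+ q - 1ℤ) * (+ q - 1ℤ)) ℤᵈ.∣-refl)

corollary2p10 : (n : ℕ) → 2 < n → 2 ∣ n → ¬ (2 ∣ n / 2) → ¬ CompleteMOFS n
corollary2p10 n 2<n (divides q n≡q*2) 2∤n/2 mofs = 2∤n/2 (subst (2 ∣_) (sym n/2≡q) 2∣q)
  where
  n/2≡q : n / 2 ≡ q
  n/2≡q = trans (cong (_/ 2) n≡q*2) (m*n/n≡m q 2)
  +n≡+q*+2 : + n ≡ + q * + 2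
  +n≡+q*+2 = trans (cong +_ n≡q*2) (ℤP.pos-* q 2)
  2∣q : 2 ∣ q
  2∣q = 4∣[2q-1][2q-4]⇒2∣q q
    (subst (λ x → + 4 ∣ℤ (x - 1ℤ) * (x - + 4)) +n≡+q*+2 (completeMOFS⇒4∣[n-1][n-4] 2<n mofs))
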